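{- Let $p$ be a prime and $t\ge 1$ an integer; set $r := p^t+1$ and $n := r(r-1)+1$. Let $f\colon\mathbb{Z}\to\mathbb{F}_p$ be the function determined by $f(k+r) = -f(k)-f(k+1)$ for all $k\in\mathbb{Z}$, together with $f(0)=1$ and $f(1)=\dots=f(r-1)=0$. Then $f(k)f(-k)=0$ for all $k\in\mathbb{Z}\setminus n\mathbb{Z}$. -}

module Defs where

open import Data.Nat as ℕ using (ℕ)
open import Data.Integer using (ℤ; _+_; _-_; _*_; -_; +_)
open import Data.Integer.Divisibility using (_∣_)

-- Congruence modulo a natural number m on ℤ: a ≡ b (mod m) iff m ∣ (a - b).
-- Elements of 𝔽_p = ℤ/pℤ are represented by integers; equality in 𝔽_p is
-- congruence modulo p.
_≡_[mod_] : ℤ → ℤ → ℕ → Set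
a ≡ b [mod m ] = (+ m) ∣ (a - b)

infix 4 _≡_[mod_]

-- Put q = p^t, so that r = q + 1 and n = q² + q + 1.  Read in rows of length q, the
-- recurrence f(k + q + 1) = - f(k) - f(k + 1) is Pascal's rule up to sign, so that
-- f(aq + b) ≡ (-1)^a C(a-1, b-1) for a ≤ q and 1 ≤ b ≤ q, which vanishes unless b ≤ a.
-- As p divides C(q, i) for 0 < i < q and (-1)^q ≡ -1, the values f(n), …, f(n + q) agree
-- with f(0), …, f(q), so f has period n.  If 0 < s < n and neither f(s) nor f(n - s)
-- vanished, then s = aq + b and n - s = a'q + b' with 2 ≤ b + b' ≤ a + a' and
-- (a + a')q + (b + b') = q² + q + 1, which is impossible.
module Submission where

open import Defs
open import Data.Nat as ℕ using (ℕ; _≥_; _^_)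
open import Data.Nat.Primality using (Prime)
open import Data.Integer using (ℤ; _+_; _-_; _*_; -_; +_)
open import Data.Integer.Divisibility using (_∣_)
open import Relation.Nullary using (¬_)

open import Data.Empty using (⊥-elim)
open import Data.Integer using (0ℤ; 1ℤ; -1ℤ; -[1+_])
import Data.Integer as ℤ
open import Data.Integer.DivMod using (_%ℕ_; _/ℕ_; a≡a%ℕn+[a/ℕn]*n; n%ℕd<d)
import Data.Integer.Divisibility.Signed as ℤ∣
import Data.Integer.Properties as ℤₚ
open import Data.Integer.Tactic.RingSolver using (solve-∀)
open import Data.Nat using (zero; suc; _≤_; _<_; _∸_; z≤n; s≤s; NonZero)
open import Data.Nat.Combinatorics
  using (_C_; nC1≡n; nCn≡1; k>n⇒nCk≡0) renaming (nCk+nC[k+1]≡[n+1]C[k+1] to pascal)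
open import Data.Nat.DivMod using (_/_; _%_; m%n<n; m≡m%n+[m/n]*n; m<n*o⇒m/o<n; %-distribˡ-*)
import Data.Nat.Divisibility as ℕ
open import Data.Nat.Primality using (euclidsLemma; prime⇒irreducible; prime⇒nonZero)
import Data.Nat.Properties as ℕₚ
import Data.Nat.Tactic.RingSolver as ℕ-Solver
open import Data.Product using (Σ-syntax; _×_; _,_)
open import Data.Sum using (_⊎_; inj₁; inj₂; [_,_]′)
open import Function using (_∘_; _∘₂_; id)
open import Relation.Binary.Bundles using (Setoid)
open import Relation.Binary.Structures using (IsEquivalence)
open import Relation.Binary.PropositionalEquality
  using (_≡_; _≢_; refl; sym; trans; cong; cong₂; subst; subst₂; module ≡-Reasoning)
import Relation.Binary.Reasoning.Setoid as SetoidReasoning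
open import Relation.Nullary using (yes; no)

[1+k]*[1+n]C[1+k]≡[1+n]*nCk : ∀ n k → suc k ℕ.* (suc n C suc k) ≡ suc n ℕ.* (n C k)
[1+k]*[1+n]C[1+k]≡[1+n]*nCk zero    zero    = refl
[1+k]*[1+n]C[1+k]≡[1+n]*nCk zero    (suc k) = ℕₚ.*-zeroʳ (suc (suc k))
[1+k]*[1+n]C[1+k]≡[1+n]*nCk (suc n) zero    = begin
  1 ℕ.* (suc (suc n) C 1)  ≡⟨ ℕₚ.*-identityˡ (suc (suc n) C 1) ⟩
  suc (suc n) C 1          ≡⟨ nC1≡n (suc (suc n)) ⟩
  suc (suc n)              ≡⟨ ℕₚ.*-identityʳ (suc (suc n)) ⟨
  suc (suc n) ℕ.* 1        ∎
  where open ≡-Reasoning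
[1+k]*[1+n]C[1+k]≡[1+n]*nCk (suc n) (suc k) = begin
  suc (suc k) ℕ.* (suc (suc n) C suc (suc k))  ≡⟨ cong (suc (suc k) ℕ.*_) (pascal (suc n) (suc k)) ⟨
  suc (suc k) ℕ.* (x ℕ.+ y)                    ≡⟨ expand (suc k) x y ⟩
  suc k ℕ.* x ℕ.+ x ℕ.+ suc (suc k) ℕ.* y      ≡⟨ cong₂ (λ u v → u ℕ.+ x ℕ.+ v)
                                                         ([1+k]*[1+n]C[1+k]≡[1+n]*nCk n k)
                                                         ([1+k]*[1+n]C[1+k]≡[1+n]*nCk n (suc k)) ⟩
  suc n ℕ.* (n C k) ℕ.+ x ℕ.+ suc n ℕ.* (n C suc k)
                                               ≡⟨ collect (suc n) (n C k) (n C suc k) x ⟩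
  suc n ℕ.* (n C k ℕ.+ n C suc k) ℕ.+ x        ≡⟨ cong (λ u → suc n ℕ.* u ℕ.+ x) (pascal n k) ⟩
  suc n ℕ.* x ℕ.+ x                            ≡⟨ ℕₚ.+-comm (suc n ℕ.* x) x ⟩
  suc (suc n) ℕ.* x                            ∎
  where
  open ≡-Reasoning
  x = suc n C suc k
  y = suc n C suc (suc k)
  expand : ∀ k x y → suc k ℕ.* (x ℕ.+ y) ≡ k ℕ.* x ℕ.+ x ℕ.+ suc k ℕ.* y
  expand = ℕ-Solver.solve-∀
  collect : ∀ m u v x → m ℕ.* u ℕ.+ x ℕ.+ m ℕ.* v ≡ m ℕ.* (u ℕ.+ v) ℕ.+ x
  collect = ℕ-Solver.solve-∀

p^t∣m*n∧p^t∤m⇒p∣n : ∀ {p} → Prime p → ∀ t {m n} → p ^ t ℕ.∣ m ℕ.* n → ¬ p ^ t ℕ.∣ m → p ℕ.∣ n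
p^t∣m*n∧p^t∤m⇒p∣n _       zero    {m} _ 1∤m = ⊥-elim (1∤m (ℕ.1∣ m))
p^t∣m*n∧p^t∤m⇒p∣n {p} p-prime (suc t) {m} {n} p^[1+t]∣mn p^[1+t]∤m
  with euclidsLemma m n p-prime (ℕ.m*n∣⇒m∣ p (p ^ t) p^[1+t]∣mn)
... | inj₂ p∣n                = p∣n
... | inj₁ (ℕ.divides j refl) = p^t∣m*n∧p^t∤m⇒p∣n p-prime t p^t∣jn p^t∤j
  where
  instance _ = prime⇒nonZero p-prime
  regroup : ∀ j p n → j ℕ.* p ℕ.* n ≡ p ℕ.* (j ℕ.* n)
  regroup = ℕ-Solver.solve-∀
  p^t∣jn : p ^ t ℕ.∣ j ℕ.* n
  p^t∣jn = ℕ.*-cancelˡ-∣ p (subst (p ℕ.* p ^ t ℕ.∣_) (regroup j p n) p^[1+t]∣mn)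
  p^t∤j : ¬ p ^ t ℕ.∣ j
  p^t∤j p^t∣j = p^[1+t]∤m (subst (p ℕ.* p ^ t ℕ.∣_) (ℕₚ.*-comm p j) (ℕ.*-monoʳ-∣ p p^t∣j))

p∣[p^t]Ck : ∀ {p} → Prime p → ∀ t {k} → 0 < k → k < p ^ t → p ℕ.∣ (p ^ t) C k
p∣[p^t]Ck {p} p-prime t {suc j} _ k<p^t with p ^ t in p^t≡q
... | suc n = p^t∣m*n∧p^t∤m⇒p∣n p-prime t p^t∣[1+j]*qC[1+j] p^t∤[1+j]
  where
  p^t∣[1+j]*qC[1+j] : p ^ t ℕ.∣ suc j ℕ.* (suc n C suc j)
  p^t∣[1+j]*qC[1+j] =
    subst₂ ℕ._∣_ (sym p^t≡q) (sym ([1+k]*[1+n]C[1+k]≡[1+n]*nCk n j)) (ℕ.m∣m*n (n C j))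
  p^t∤[1+j] : ¬ p ^ t ℕ.∣ suc j
  p^t∤[1+j] = subst (λ q → ¬ q ℕ.∣ suc j) (sym p^t≡q) (ℕ.>⇒∤ k<p^t)

-- The congruence of Defs, wrapped in a record so that its type determines a, b and m.
infix 4 _≈_[mod_]
record _≈_[mod_] (a b : ℤ) (m : ℕ) : Set where
  constructor wrap
  field unwrap : a ≡ b [mod m ]
open _≈_[mod_] public

module _ {m : ℕ} where

  private
    ∣⇒≈ : ∀ {a b} → + m ℤ∣.∣ a - b → a ≈ b [mod m ]
    ∣⇒≈ = wrap ∘ ℤ∣.∣⇒∣ᵤ

    ≈⇒∣ : ∀ {a b} → a ≈ b [mod m ] → + m ℤ∣.∣ a - b
    ≈⇒∣ = ℤ∣.∣ᵤ⇒∣ ∘ unwrap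

  ≈-reflexive : ∀ {a b} → a ≡ b → a ≈ b [mod m ]
  ≈-reflexive {a} refl = ∣⇒≈ (ℤ∣.divides 0ℤ (ℤₚ.+-inverseʳ a))

  ≈-refl : ∀ {a} → a ≈ a [mod m ]
  ≈-refl = ≈-reflexive refl

  ≈-sym : ∀ {a b} → a ≈ b [mod m ] → b ≈ a [mod m ]
  ≈-sym {a} {b} a≈b = ∣⇒≈ (subst (+ m ℤ∣.∣_) (swap a b) (ℤ∣.∣m⇒∣-m (≈⇒∣ a≈b)))
    where swap : ∀ a b → - (a - b) ≡ b - a
          swap = solve-∀

  ≈-trans : ∀ {a b c} → a ≈ b [mod m ] → b ≈ c [mod m ] → a ≈ c [mod m ]
  ≈-trans {a} {b} {c} a≈b b≈c =
    ∣⇒≈ (subst (+ m ℤ∣.∣_) (telescope a b c) (ℤ∣.∣m∣n⇒∣m+n (≈⇒∣ a≈b) (≈⇒∣ b≈c)))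
    where telescope : ∀ a b c → (a - b) + (b - c) ≡ a - c
          telescope = solve-∀

  -‿cong : ∀ {a b} → a ≈ b [mod m ] → - a ≈ - b [mod m ]
  -‿cong {a} {b} a≈b = ∣⇒≈ (subst (+ m ℤ∣.∣_) (neg-distrib a b) (ℤ∣.∣m⇒∣-m (≈⇒∣ a≈b)))
    where neg-distrib : ∀ a b → - (a - b) ≡ - a - - b
          neg-distrib = solve-∀

  +-cong : ∀ {a b c d} → a ≈ b [mod m ] → c ≈ d [mod m ] → a + c ≈ b + d [mod m ]
  +-cong {a} {b} {c} {d} a≈b c≈d =
    ∣⇒≈ (subst (+ m ℤ∣.∣_) (interchange a b c d) (ℤ∣.∣m∣n⇒∣m+n (≈⇒∣ a≈b) (≈⇒∣ c≈d)))
    where interchange : ∀ a b c d → (a - b) + (c - d) ≡ (a + c) - (b + d)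
          interchange = solve-∀

  sub-cong : ∀ {a b c d} → a ≈ b [mod m ] → c ≈ d [mod m ] → a - c ≈ b - d [mod m ]
  sub-cong a≈b c≈d = +-cong a≈b (-‿cong c≈d)

  *-cong : ∀ {a b c d} → a ≈ b [mod m ] → c ≈ d [mod m ] → a * c ≈ b * d [mod m ]
  *-cong {a} {b} {c} {d} a≈b c≈d =
    ∣⇒≈ (subst (+ m ℤ∣.∣_) (split a b c d)
      (ℤ∣.∣m∣n⇒∣m+n (ℤ∣.∣m⇒∣m*n c (≈⇒∣ a≈b)) (ℤ∣.∣n⇒∣m*n b (≈⇒∣ c≈d))))
    where split : ∀ a b c d → (a - b) * c + b * (c - d) ≡ a * c - b * d
          split = solve-∀

  *-congˡ : ∀ a {b c} → b ≈ c [mod m ] → a * b ≈ a * c [mod m ]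
  *-congˡ a = *-cong (≈-refl {a})

  *-congʳ : ∀ c {a b} → a ≈ b [mod m ] → a * c ≈ b * c [mod m ]
  *-congʳ c a≈b = *-cong a≈b (≈-refl {c})

  m∣n⇒n≈0 : ∀ {n} → m ℕ.∣ n → + n ≈ 0ℤ [mod m ]
  m∣n⇒n≈0 {n} (ℕ.divides k n≡km) = ∣⇒≈ (ℤ∣.divides (+ k) (begin
    + n - 0ℤ    ≡⟨ ℤₚ.+-identityʳ (+ n) ⟩
    + n         ≡⟨ cong +_ n≡km ⟩
    + (k ℕ.* m) ≡⟨ ℤₚ.pos-* k m ⟩
    + k * + m   ∎))
    where open ≡-Reasoning

≈-isEquivalence : ∀ m → IsEquivalence (_≈_[mod m ])
≈-isEquivalence m = record { refl = ≈-refl ; sym = ≈-sym ; trans = ≈-trans }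

≈-setoid : ℕ → Setoid _ _
≈-setoid m = record { isEquivalence = ≈-isEquivalence m }

module ≈-Reasoning (m : ℕ) = SetoidReasoning (≈-setoid m)

-1^n≡-1^[n%2] : ∀ n → -1ℤ ℤ.^ n ≡ -1ℤ ℤ.^ (n % 2)
-1^n≡-1^[n%2] zero          = refl
-1^n≡-1^[n%2] (suc zero)    = refl
-1^n≡-1^[n%2] (suc (suc n)) = trans (square (-1ℤ ℤ.^ n)) (-1^n≡-1^[n%2] n)
  where square : ∀ x → -1ℤ * (-1ℤ * x) ≡ x
        square = solve-∀

-1^n≈-1[mod2] : ∀ n → -1ℤ ℤ.^ n ≈ -1ℤ [mod 2 ]
-1^n≈-1[mod2] n with n % 2 | m%n<n n 2 | -1^n≡-1^[n%2] n
... | 0           | _            | eq = ≈-trans (≈-reflexive eq) (wrap (ℕ.divides 1 refl))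
... | 1           | _            | eq = ≈-reflexive eq
... | suc (suc _) | s≤s (s≤s ()) | _

m%2≡1⇒m^n%2≡1 : ∀ {m} n → m % 2 ≡ 1 → m ^ n % 2 ≡ 1
m%2≡1⇒m^n%2≡1     zero    _     = refl
m%2≡1⇒m^n%2≡1 {m} (suc n) m%2≡1 = begin
  m ℕ.* m ^ n % 2              ≡⟨ %-distribˡ-* m (m ^ n) 2 ⟩
  (m % 2) ℕ.* (m ^ n % 2) % 2  ≡⟨ cong₂ (λ x y → x ℕ.* y % 2) m%2≡1 (m%2≡1⇒m^n%2≡1 n m%2≡1) ⟩
  1                            ∎
  where open ≡-Reasoning

prime⇒≡2⊎%2≡1 : ∀ {p} → Prime p → p ≡ 2 ⊎ p % 2 ≡ 1
prime⇒≡2⊎%2≡1 {p} p-prime with p % 2 in p%2≡r | m%n<n p 2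
... | 0           | _            =
  inj₁ (sym ([ (λ ()) , id ]′ (prime⇒irreducible p-prime (ℕ.m%n≡0⇒n∣m p 2 p%2≡r))))
... | 1           | _            = inj₂ refl
... | suc (suc _) | s≤s (s≤s ())

-1^[p^t]≈-1 : ∀ {p} → Prime p → ∀ t → -1ℤ ℤ.^ (p ^ t) ≈ -1ℤ [mod p ]
-1^[p^t]≈-1 {p} p-prime t with prime⇒≡2⊎%2≡1 p-prime
... | inj₁ refl  = -1^n≈-1[mod2] (2 ^ t)
... | inj₂ p%2≡1 = ≈-reflexive (begin
  -1ℤ ℤ.^ (p ^ t)        ≡⟨ -1^n≡-1^[n%2] (p ^ t) ⟩
  -1ℤ ℤ.^ (p ^ t % 2)    ≡⟨ cong (-1ℤ ℤ.^_) (m%2≡1⇒m^n%2≡1 t p%2≡1) ⟩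
  -1ℤ                    ∎)
  where open ≡-Reasoning

Recurrent : ℕ → ℕ → (ℤ → ℤ) → Set
Recurrent m r f = ∀ k → f (k + + r) ≈ - f k - f (k + 1ℤ) [mod m ]

module _ {m r : ℕ} {f : ℤ → ℤ} (f-rec : Recurrent m r f) where
  open ≈-Reasoning m

  recurrent-backward : ∀ k → f k ≈ - f (k + + r) - f (k + 1ℤ) [mod m ]
  recurrent-backward k = begin
    f k                                  ≡⟨ solve-for-first (f k) (f (k + 1ℤ)) ⟩
    - (- f k - f (k + 1ℤ)) - f (k + 1ℤ)  ≈⟨ sub-cong (-‿cong (≈-sym (f-rec k))) ≈-refl ⟩
    - f (k + + r) - f (k + 1ℤ)           ∎
    where solve-for-first : ∀ x y → x ≡ - (- x - y) - y
          solve-for-first = solve-∀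

  recurrent-shift : ∀ n → Recurrent m r (λ z → f (z + n))
  recurrent-shift n k = begin
    f (k + + r + n)               ≡⟨ cong f (swap k (+ r) n) ⟩
    f (k + n + + r)               ≈⟨ f-rec (k + n) ⟩
    - f (k + n) - f (k + n + 1ℤ)  ≡⟨ cong (λ x → - f (k + n) - f x) (swap k n 1ℤ) ⟩
    - f (k + n) - f (k + 1ℤ + n)  ∎
    where swap : ∀ x y z → x + y + z ≡ x + z + y
          swap = solve-∀

module _ {m c : ℕ} {g h : ℤ → ℤ}
         (g-rec : Recurrent m (suc (suc c)) g) (h-rec : Recurrent m (suc (suc c)) h) where
  open ≈-Reasoning m

  private
    AgreeFrom : ℤ → Set
    AgreeFrom z = ∀ i → i < suc (suc c) → g (z + + i) ≈ h (z + + i) [mod m ]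

    agree-at : ∀ {x y} → x ≡ y → g x ≈ h x [mod m ] → g y ≈ h y [mod m ]
    agree-at = subst (λ x → g x ≈ h x [mod m ])

    slide-up : ∀ z → AgreeFrom z → AgreeFrom (z + 1ℤ)
    slide-up z agree i i<2+c with ℕₚ.m<1+n⇒m<n∨m≡n i<2+c
    ... | inj₁ i<1+c = agree-at (sym (ℤₚ.+-assoc z 1ℤ (+ i))) (agree (suc i) (s≤s i<1+c))
    ... | inj₂ refl  = agree-at (sym (ℤₚ.+-assoc z 1ℤ (+ suc c))) (begin
      g (z + + suc (suc c))  ≈⟨ g-rec z ⟩
      - g z - g (z + 1ℤ)     ≈⟨ sub-cong (-‿cong agree-z) (agree 1 (s≤s (s≤s z≤n))) ⟩
      - h z - h (z + 1ℤ)     ≈⟨ h-rec z ⟨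
      h (z + + suc (suc c))  ∎)
      where agree-z = agree-at (ℤₚ.+-identityʳ z) (agree 0 (s≤s z≤n))

    slide-down : ∀ z → AgreeFrom (z + 1ℤ) → AgreeFrom z
    slide-down z agree (suc i) (s≤s i<1+c) =
      agree-at (ℤₚ.+-assoc z 1ℤ (+ i)) (agree i (ℕₚ.m<n⇒m<1+n i<1+c))
    slide-down z agree zero    _           = agree-at (sym (ℤₚ.+-identityʳ z)) (begin
      g z                                   ≈⟨ recurrent-backward g-rec z ⟩
      - g (z + + suc (suc c)) - g (z + 1ℤ)  ≈⟨ sub-cong (-‿cong agree-z+r) agree-z+1 ⟩
      - h (z + + suc (suc c)) - h (z + 1ℤ)  ≈⟨ recurrent-backward h-rec z ⟨
      h z                                   ∎)
      where
      agree-z+r = agree-at (ℤₚ.+-assoc z 1ℤ (+ suc c)) (agree (suc c) ℕₚ.≤-refl)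
      agree-z+1 = agree-at (ℤₚ.+-identityʳ (z + 1ℤ)) (agree 0 (s≤s z≤n))

  recurrent-unique : (∀ i → i < suc (suc c) → g (+ i) ≈ h (+ i) [mod m ]) →
                     ∀ z → g z ≈ h z [mod m ]
  recurrent-unique agree-init z = agree-at (ℤₚ.+-identityʳ z) (agree-from z 0 (s≤s z≤n))
    where
    agree-from-nonneg : ∀ n → AgreeFrom (+ n)
    agree-from-nonneg zero    = agree-init
    agree-from-nonneg (suc n) =
      subst AgreeFrom (cong +_ (ℕₚ.+-comm n 1)) (slide-up (+ n) (agree-from-nonneg n))

    agree-from-neg : ∀ n → AgreeFrom -[1+ n ]
    agree-from-neg zero    = slide-down -[1+ 0 ] agree-init
    agree-from-neg (suc n) = slide-down -[1+ suc n ] (agree-from-neg n)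

    agree-from : ∀ z → AgreeFrom z
    agree-from (+ n)    = agree-from-nonneg n
    agree-from -[1+ n ] = agree-from-neg n

module _ {m : ℕ} {f : ℤ → ℤ} {n : ℤ} (f-per : ∀ z → f (z + n) ≈ f z [mod m ]) where
  open ≈-Reasoning m

  private
    periodic-multiple-pos : ∀ z k → f (z + + k * n) ≈ f z [mod m ]
    periodic-multiple-pos z zero    = ≈-reflexive (cong f (add-zero z n))
      where add-zero : ∀ z n → z + 0ℤ * n ≡ z
            add-zero = solve-∀
    periodic-multiple-pos z (suc k) = begin
      f (z + + suc k * n)  ≡⟨ cong f (peel z (+ k) n) ⟩
      f (z + + k * n + n)  ≈⟨ f-per (z + + k * n) ⟩
      f (z + + k * n)      ≈⟨ periodic-multiple-pos z k ⟩
      f z                  ∎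
      where peel : ∀ z k n → z + (1ℤ + k) * n ≡ z + k * n + n
            peel = solve-∀

  periodic-multiple : ∀ z w → f (z + w * n) ≈ f z [mod m ]
  periodic-multiple z (+ k)    = periodic-multiple-pos z k
  periodic-multiple z -[1+ k ] = ≈-sym (begin
    f z                                 ≡⟨ cong f (cancel z (+ suc k) n) ⟩
    f (z + -[1+ k ] * n + + suc k * n)  ≈⟨ periodic-multiple-pos (z + -[1+ k ] * n) (suc k) ⟩
    f (z + -[1+ k ] * n)                ∎)
    where cancel : ∀ z k n → z ≡ z + (- k) * n + k * n
          cancel = solve-∀

%ℕ≡0⇒∣ : ∀ k N .{{_ : NonZero N}} → k %ℕ N ≡ 0 → + N ∣ k
%ℕ≡0⇒∣ k N k%N≡0 = ℤ∣.∣⇒∣ᵤ (ℤ∣.divides (k /ℕ N) (begin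
  k                            ≡⟨ a≡a%ℕn+[a/ℕn]*n k N ⟩
  + (k %ℕ N) + (k /ℕ N) * + N  ≡⟨ cong (λ s → + s + (k /ℕ N) * + N) k%N≡0 ⟩
  0ℤ + (k /ℕ N) * + N          ≡⟨ ℤₚ.+-identityˡ ((k /ℕ N) * + N) ⟩
  (k /ℕ N) * + N               ∎))
  where open ≡-Reasoning

module _ {m N : ℕ} .{{_ : NonZero N}} {f : ℤ → ℤ} (f-per : ∀ z → f (z + + N) ≈ f z [mod m ]) where
  open ≈-Reasoning m

  periodic-%ℕ : ∀ k → f k ≈ f (+ (k %ℕ N)) [mod m ]
  periodic-%ℕ k = begin
    f k                              ≡⟨ cong f (a≡a%ℕn+[a/ℕn]*n k N) ⟩
    f (+ (k %ℕ N) + (k /ℕ N) * + N)  ≈⟨ periodic-multiple f-per (+ (k %ℕ N)) (k /ℕ N) ⟩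
    f (+ (k %ℕ N))                   ∎

  periodic-neg-%ℕ : ∀ k → f (- k) ≈ f (+ (N ∸ k %ℕ N)) [mod m ]
  periodic-neg-%ℕ k = begin
    f (- k)                                ≡⟨ cong (f ∘ -_) (a≡a%ℕn+[a/ℕn]*n k N) ⟩
    f (- (+ s + w * + N))                  ≡⟨ cong f (negate (+ s) w (+ N)) ⟩
    f (- + s + (- w) * + N)                ≈⟨ periodic-multiple f-per (- + s) (- w) ⟩
    f (- + s)                              ≈⟨ f-per (- + s) ⟨
    f (- + s + + N)                        ≡⟨ cong f (ℤₚ.-m+n≡n⊖m s N) ⟩
    f (N ℤ.⊖ s)                            ≡⟨ cong f (ℤₚ.⊖-≥ (ℕₚ.<⇒≤ (n%ℕd<d k N))) ⟩
    f (+ (N ∸ s))                          ∎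
    where
    s = k %ℕ N
    w = k /ℕ N
    negate : ∀ s w n → - (s + w * n) ≡ - s + (- w) * n
    negate = solve-∀

-- E a b = (-1)^a C(a-1, b-1) is the value of the solution at aq + b.
E : ℕ → ℕ → ℤ
E zero    zero    = 1ℤ
E zero    (suc b) = 0ℤ
E (suc a) zero    = 0ℤ
E (suc a) (suc b) = -1ℤ ℤ.^ suc a * + (a C b)

E-rec : ∀ a b → E (suc a) (suc b) ≡ - E a b - E a (suc b)
E-rec zero    zero    = refl
E-rec zero    (suc b) = refl
E-rec (suc a) zero    = flip (-1ℤ ℤ.^ suc a)
  where flip : ∀ x → -1ℤ * x * 1ℤ ≡ - 0ℤ - x * 1ℤ
        flip = solve-∀
E-rec (suc a) (suc b) = begin
  -1ℤ * σ * + (suc a C suc b)            ≡⟨ cong (λ n → -1ℤ * σ * + n) (pascal a b) ⟨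
  -1ℤ * σ * + (a C b ℕ.+ a C suc b)      ≡⟨ cong (-1ℤ * σ *_) (ℤₚ.pos-+ (a C b) (a C suc b)) ⟩
  -1ℤ * σ * (+ (a C b) + + (a C suc b))  ≡⟨ distribute σ (+ (a C b)) (+ (a C suc b)) ⟩
  - (σ * + (a C b)) - σ * + (a C suc b)  ∎
  where
  open ≡-Reasoning
  σ = -1ℤ ℤ.^ suc a
  distribute : ∀ x y z → -1ℤ * x * (y + z) ≡ - (x * y) - x * z
  distribute = solve-∀

E-vanishes : ∀ {a b} → a ≤ b → E a (suc b) ≡ 0ℤ
E-vanishes {zero}  _     = refl
E-vanishes {suc a} 1+a≤b =
  trans (cong (λ n → -1ℤ ℤ.^ suc a * + n) (k>n⇒nCk≡0 1+a≤b)) (ℤₚ.*-zeroʳ (-1ℤ ℤ.^ suc a))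

E-support : ∀ a b → E a (suc b) ≡ 0ℤ ⊎ b < a
E-support a b with ℕₚ.<-≤-connex b a
... | inj₁ b<a = inj₂ b<a
... | inj₂ a≤b = inj₁ (E-vanishes a≤b)

E-corner : ∀ c → - E (suc c) (suc c) - E (suc (suc c)) 1 ≡ 0ℤ
E-corner c rewrite nCn≡1 c = cancel (-1ℤ ℤ.^ suc c)
  where cancel : ∀ σ → - (σ * 1ℤ) - -1ℤ * σ * 1ℤ ≡ 0ℤ
        cancel = solve-∀

A*q+B≢[1+q]*q+1 : ∀ {q A B} → 2 ≤ B → B ≤ A → A ℕ.* q ℕ.+ B ≢ suc q ℕ.* q ℕ.+ 1
A*q+B≢[1+q]*q+1 {q} {A} {B} 2≤B B≤A eq with ℕₚ.≤-<-connex A q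
... | inj₁ A≤q = ℕₚ.<-irrefl eq (begin-strict
  A ℕ.* q ℕ.+ B      ≤⟨ ℕₚ.+-monoʳ-≤ (A ℕ.* q) B≤A ⟩
  A ℕ.* q ℕ.+ A      ≡⟨ factor A q ⟩
  suc q ℕ.* A        ≤⟨ ℕₚ.*-monoʳ-≤ (suc q) A≤q ⟩
  suc q ℕ.* q        <⟨ ℕₚ.m<m+n (suc q ℕ.* q) (s≤s z≤n) ⟩
  suc q ℕ.* q ℕ.+ 1  ∎)
  where
  open ℕₚ.≤-Reasoning
  factor : ∀ A q → A ℕ.* q ℕ.+ A ≡ suc q ℕ.* A
  factor = ℕ-Solver.solve-∀
... | inj₂ q<A = ℕₚ.<-irrefl (sym eq) (begin-strict
  suc q ℕ.* q ℕ.+ 1  <⟨ ℕₚ.+-monoʳ-< (suc q ℕ.* q) (s≤s (s≤s z≤n)) ⟩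
  suc q ℕ.* q ℕ.+ 2  ≤⟨ ℕₚ.+-mono-≤ (ℕₚ.*-monoˡ-≤ q q<A) 2≤B ⟩
  A ℕ.* q ℕ.+ B      ∎)
  where open ℕₚ.≤-Reasoning

module Triangle {m c : ℕ} {f : ℤ → ℤ}
                (f-rec : Recurrent m (suc (suc c)) f)
                (f-0 : f 0ℤ ≈ 1ℤ [mod m ])
                (f-init : ∀ i → 1 ≤ i → i < suc (suc c) → f (+ i) ≈ 0ℤ [mod m ]) where
  open ≈-Reasoning m

  q : ℕ
  q = suc c

  N : ℕ
  N = suc q ℕ.* q ℕ.+ 1

  F : ℕ → ℤ
  F x = f (+ x)

  -- Row a also covers b = q, where aq + q = (a+1)q + 0; row 0 is then the initial data.
  Row : ℕ → Set
  Row a = ∀ b → b ≤ q → F (a ℕ.* q ℕ.+ b) ≈ E a b [mod m ]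

  row-next : ∀ a → Row a → ∀ b → b < q → F (suc a ℕ.* q ℕ.+ suc b) ≈ E (suc a) (suc b) [mod m ]
  row-next a row b b<q = begin
    F (suc a ℕ.* q ℕ.+ suc b)                          ≡⟨ cong F (up a b c) ⟩
    F (x ℕ.+ suc q)                                    ≈⟨ f-rec (+ x) ⟩
    - F x - F (x ℕ.+ 1)                                ≡⟨ cong (λ y → - F x - F y) (right a b c) ⟩
    - F (a ℕ.* q ℕ.+ b) - F (a ℕ.* q ℕ.+ suc b)        ≈⟨ sub-cong (-‿cong (row b (ℕₚ.<⇒≤ b<q)))
                                                                  (row (suc b) b<q) ⟩
    - E a b - E a (suc b)                              ≡⟨ E-rec a b ⟨
    E (suc a) (suc b)                                  ∎
    where
    x = a ℕ.* q ℕ.+ b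
    up : ∀ a b c → suc a ℕ.* suc c ℕ.+ suc b ≡ a ℕ.* suc c ℕ.+ b ℕ.+ suc (suc c)
    up = ℕ-Solver.solve-∀
    right : ∀ a b c → a ℕ.* suc c ℕ.+ b ℕ.+ 1 ≡ a ℕ.* suc c ℕ.+ suc b
    right = ℕ-Solver.solve-∀

  row : ∀ a → a ≤ q → Row a
  row zero    _         zero    _     = f-0
  row zero    _         (suc b) b<q   = f-init (suc b) (s≤s z≤n) (s≤s b<q)
  row (suc a) (s≤s a≤c) zero    _     = begin
    F (suc a ℕ.* q ℕ.+ 0)  ≡⟨ cong F (end-of-previous-row a c) ⟩
    F (a ℕ.* q ℕ.+ q)      ≈⟨ row a (ℕₚ.m≤n⇒m≤1+n a≤c) q ℕₚ.≤-refl ⟩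
    E a q                  ≡⟨ E-vanishes a≤c ⟩
    0ℤ                     ∎
    where end-of-previous-row : ∀ a c → suc a ℕ.* suc c ℕ.+ 0 ≡ a ℕ.* suc c ℕ.+ suc c
          end-of-previous-row = ℕ-Solver.solve-∀
  row (suc a) (s≤s a≤c) (suc b) 1+b≤q = row-next a (row a (ℕₚ.m≤n⇒m≤1+n a≤c)) b 1+b≤q

  decompose : ∀ {s} → 0 < s → s < N →
              Σ[ a ∈ ℕ ] Σ[ b ∈ ℕ ] a ≤ q × b < q × s ≡ a ℕ.* q ℕ.+ suc b
  decompose {suc s} _ 1+s<N = s / q , s % q , ℕₚ.≤-pred (m<n*o⇒m/o<n s<[1+q]*q) , m%n<n s q , split
    where
    s<[1+q]*q : s < suc q ℕ.* q
    s<[1+q]*q = ℕₚ.≤-pred (subst (suc (suc s) ≤_) (ℕₚ.+-comm (suc q ℕ.* q) 1) 1+s<N)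
    shift : ∀ x y → suc (x ℕ.+ y) ≡ y ℕ.+ suc x
    shift = ℕ-Solver.solve-∀
    split : suc s ≡ s / q ℕ.* q ℕ.+ suc (s % q)
    split = trans (cong suc (m≡m%n+[m/n]*n s q)) (shift (s % q) (s / q ℕ.* q))

  private
    row-entry : ∀ {x a b} → x ≡ a ℕ.* q ℕ.+ suc b → a ≤ q → b < q → F x ≈ E a (suc b) [mod m ]
    row-entry {a = a} {b} refl a≤q b<q = row a a≤q (suc b) b<q

  support : ∀ s → 0 < s → s < N → F s ≈ 0ℤ [mod m ] ⊎ F (N ∸ s) ≈ 0ℤ [mod m ]
  support s 0<s s<N
    with decompose 0<s s<N | decompose (ℕₚ.m<n⇒0<n∸m s<N) (ℕₚ.∸-monoʳ-< 0<s (ℕₚ.<⇒≤ s<N))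
  ... | a , b , a≤q , b<q , s≡ | a′ , b′ , a′≤q , b′<q , N-s≡
    with E-support a b | E-support a′ b′
  ... | inj₁ E≡0  | _          = inj₁ (≈-trans (row-entry s≡ a≤q b<q) (≈-reflexive E≡0))
  ... | _         | inj₁ E≡0   = inj₂ (≈-trans (row-entry N-s≡ a′≤q b′<q) (≈-reflexive E≡0))
  ... | inj₂ b<a  | inj₂ b′<a′ =
    ⊥-elim (A*q+B≢[1+q]*q+1 (ℕₚ.+-mono-≤ (s≤s z≤n) (s≤s z≤n)) (ℕₚ.+-mono-≤ b<a b′<a′) total)
    where
    regroup : ∀ a a′ q b b′ → (a ℕ.+ a′) ℕ.* q ℕ.+ (b ℕ.+ b′) ≡ (a ℕ.* q ℕ.+ b) ℕ.+ (a′ ℕ.* q ℕ.+ b′)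
    regroup = ℕ-Solver.solve-∀
    total : (a ℕ.+ a′) ℕ.* q ℕ.+ (suc b ℕ.+ suc b′) ≡ N
    total = trans (regroup a a′ q (suc b) (suc b′))
                  (trans (sym (cong₂ ℕ._+_ s≡ N-s≡)) (ℕₚ.m+[n∸m]≡n (ℕₚ.<⇒≤ s<N)))

  module _ (q-binomial : ∀ i → 0 < i → i < q → m ℕ.∣ q C i)
           (q-sign : -1ℤ ℤ.^ q ≈ -1ℤ [mod m ]) where

    period-on-window : ∀ i → i < suc q → f (+ i + + N) ≈ f (+ i) [mod m ]
    period-on-window i i<1+q with ℕₚ.m<1+n⇒m<n∨m≡n i<1+q
    ... | inj₁ i<q = begin
      F (i ℕ.+ N)                  ≡⟨ cong F (into-row-q+1 i c) ⟩
      F (suc q ℕ.* q ℕ.+ suc i)    ≈⟨ row-next q (row q ℕₚ.≤-refl) i i<q ⟩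
      -1ℤ * -1ℤ ℤ.^ q * + (q C i)  ≈⟨ *-congʳ (+ (q C i)) (*-congˡ -1ℤ q-sign) ⟩
      1ℤ * + (q C i)               ≡⟨ ℤₚ.*-identityˡ (+ (q C i)) ⟩
      + (q C i)                    ≈⟨ binomial i i<q ⟩
      F i                          ∎
      where
      into-row-q+1 : ∀ i c → i ℕ.+ (suc (suc c) ℕ.* suc c ℕ.+ 1) ≡ suc (suc c) ℕ.* suc c ℕ.+ suc i
      into-row-q+1 = ℕ-Solver.solve-∀
      binomial : ∀ i → i < q → + (q C i) ≈ F i [mod m ]
      binomial zero    _   = ≈-sym f-0
      binomial (suc i) i<q = ≈-trans (m∣n⇒n≈0 (q-binomial (suc i) (s≤s z≤n) i<q))
                                     (≈-sym (f-init (suc i) (s≤s z≤n) (ℕₚ.m<n⇒m<1+n i<q)))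
    ... | inj₂ refl = begin
      F (q ℕ.+ N)                     ≡⟨ cong F (corner c) ⟩
      F (x ℕ.+ suc q)                 ≈⟨ f-rec (+ x) ⟩
      - F x - F (x ℕ.+ 1)             ≡⟨ cong (λ y → - F x - F y) (start-of-row-q+1 c) ⟩
      - F x - F (suc q ℕ.* q ℕ.+ 1)   ≈⟨ sub-cong (-‿cong (row q ℕₚ.≤-refl q ℕₚ.≤-refl))
                                                  (row-next q (row q ℕₚ.≤-refl) 0 (s≤s z≤n)) ⟩
      - E q q - E (suc q) 1           ≡⟨ E-corner c ⟩
      0ℤ                              ≈⟨ f-init q (s≤s z≤n) ℕₚ.≤-refl ⟨
      F q                             ∎
      where
      x = q ℕ.* q ℕ.+ q
      corner : ∀ c → suc c ℕ.+ (suc (suc c) ℕ.* suc c ℕ.+ 1)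
                   ≡ suc c ℕ.* suc c ℕ.+ suc c ℕ.+ suc (suc c)
      corner = ℕ-Solver.solve-∀
      start-of-row-q+1 : ∀ c → suc c ℕ.* suc c ℕ.+ suc c ℕ.+ 1 ≡ suc (suc c) ℕ.* suc c ℕ.+ 1
      start-of-row-q+1 = ℕ-Solver.solve-∀

    period : ∀ z → f (z + + N) ≈ f z [mod m ]
    period = recurrent-unique {h = f} (recurrent-shift {f = f} f-rec (+ N)) f-rec period-on-window

    product-vanishes : ∀ k → ¬ (+ N ∣ k) → f k * f (- k) ≈ 0ℤ [mod m ]
    product-vanishes k N∤k with k %ℕ N ℕ.≟ 0
    ... | yes k%N≡0 = ⊥-elim (N∤k (%ℕ≡0⇒∣ k N k%N≡0))
    ... | no  k%N≢0 with support (k %ℕ N) (ℕₚ.n≢0⇒n>0 k%N≢0) (n%ℕd<d k N)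
    ...   | inj₁ F[k%N]≈0 = begin
      f k * f (- k)  ≈⟨ *-congʳ (f (- k)) (≈-trans (periodic-%ℕ period k) F[k%N]≈0) ⟩
      0ℤ * f (- k)   ≡⟨ ℤₚ.*-zeroˡ (f (- k)) ⟩
      0ℤ             ∎
    ...   | inj₂ F[N-k%N]≈0 = begin
      f k * f (- k)  ≈⟨ *-congˡ (f k) (≈-trans (periodic-neg-%ℕ period k) F[N-k%N]≈0) ⟩
      f k * 0ℤ       ≡⟨ ℤₚ.*-zeroʳ (f k) ⟩
      0ℤ             ∎

lemma3p4-general : ∀ m q → 0 < q → (∀ i → 0 < i → i < q → m ℕ.∣ q C i) →
  -1ℤ ℤ.^ q ≈ -1ℤ [mod m ] →
  let r = q ℕ.+ 1
      n = r ℕ.* (r ℕ.∸ 1) ℕ.+ 1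
  in (f : ℤ → ℤ) →
     (∀ k → f (k + + r) ≡ - f k - f (k + + 1) [mod m ]) →
     f (+ 0) ≡ + 1 [mod m ] →
     (∀ (i : ℕ) → 1 ℕ.≤ i → i ℕ.< r → f (+ i) ≡ + 0 [mod m ]) →
     ∀ (k : ℤ) → ¬ ((+ n) ∣ k) → f k * f (- k) ≡ + 0 [mod m ]
lemma3p4-general m (suc c) _ q-binomial q-sign rewrite ℕₚ.+-comm c 1 = λ f f-rec f-0 f-init →
  unwrap ∘₂ Triangle.product-vanishes {f = f} (wrap ∘ f-rec) (wrap f-0)
    (λ i 1≤i i<r → wrap (f-init i 1≤i i<r)) q-binomial q-sign

lemma3p4 : (p t : ℕ) → Prime p → t ≥ 1 →
  let r = p ^ t ℕ.+ 1
      n = r ℕ.* (r ℕ.∸ 1) ℕ.+ 1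
  in (f : ℤ → ℤ) →
     (∀ k → f (k + + r) ≡ - f k - f (k + + 1) [mod p ]) →
     f (+ 0) ≡ + 1 [mod p ] →
     (∀ (i : ℕ) → 1 ℕ.≤ i → i ℕ.< r → f (+ i) ≡ + 0 [mod p ]) →
     ∀ (k : ℤ) → ¬ ((+ n) ∣ k) → f k * f (- k) ≡ + 0 [mod p ]
lemma3p4 p t p-prime _ =
  lemma3p4-general p (p ^ t) (ℕₚ.m^n>0 p t) (λ _ → p∣[p^t]Ck p-prime t) (-1^[p^t]≈-1 p-prime t)
  where instance _ = prime⇒nonZero p-prime
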